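{- Let $G$ be a connected finite simple graph with $|E_G|\ge 2$. If there is a set $E_c$ of connecting edges of $G$ such that $E_c$ separates $G$ (i.e., the graph $(V_G,E_G\setminus E_c)$ is disconnected) and the subgraph of $G$ induced by $E_c$ contains no path of length four, then $G$ has a NAC-coloring.
   Context: An edge of $G$ is a connecting edge if it belongs to no triangle (subgraph isomorphic to $C_3$) of $G$. The subgraph induced by an edge set $E_c$ consists of the edges in $E_c$ together with their endpoints; the length of a path is its number of edges. A coloring $\delta\colon E_G\to\{\text{blue},\text{red}\}$ is a NAC-coloring if it is surjective and $G$ contains no cycle with exactly one blue edge and no cycle with exactly one red edge. -}

module Defs where

open import Data.Nat using (ℕ; zero; suc; _+_; _≤_)
open import Data.Fin using (Fin)
open import Data.Bool using (Bool; true; false)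
open import Data.List using (List; []; _∷_; length)
open import Data.List.Relation.Unary.All using (All)
open import Data.List.Relation.Unary.Unique.Propositional using (Unique)
open import Data.Product using (Σ; ∃; ∃-syntax; _×_; _,_; proj₁; proj₂)
open import Relation.Binary.PropositionalEquality using (_≡_; _≢_)
open import Relation.Nullary using (¬_)

-- An (undirected) edge {u,v} is
-- represented by either ordered pair (u,v) with adj u v ≡ true.
record Graph : Set where
  field
    n      : ℕ
    adj    : Fin n → Fin n → Bool
    sym    : ∀ u v → adj u v ≡ adj v u
    irrefl : ∀ u → adj u u ≡ false
open Graph public

data Walk {n : ℕ} (R : Fin n → Fin n → Set) : Fin n → Fin n → Set where
  here : ∀ {u} → Walk R u u
  step : ∀ {u v w} → R u v → Walk R v w → Walk R u w

ConnectedRel : {n : ℕ} → (Fin n → Fin n → Set) → Set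
ConnectedRel {n} R = (u v : Fin n) → Walk R u v

IsEdge : (G : Graph) → Fin (n G) → Fin (n G) → Set
IsEdge G u v = adj G u v ≡ true

Connected : Graph → Set
Connected G = ConnectedRel (IsEdge G)

AtLeastTwoEdges : Graph → Set
AtLeastTwoEdges G =
  Σ (Fin (n G)) λ u → Σ (Fin (n G)) λ v → Σ (Fin (n G)) λ x → Σ (Fin (n G)) λ y →
    IsEdge G u v × IsEdge G x y ×
    ¬ ((u ≡ x × v ≡ y) ⊎' (u ≡ y × v ≡ x))
  where
  open import Data.Sum using () renaming (_⊎_ to _⊎'_)

IsConnectingEdge : (G : Graph) → Fin (n G) → Fin (n G) → Set
IsConnectingEdge G u v = IsEdge G u v × ¬ (∃[ w ] (IsEdge G u w × IsEdge G v w))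

record EdgeSet (G : Graph) : Set₁ where
  field
    mem     : Fin (n G) → Fin (n G) → Set
    memSym  : ∀ {u v} → mem u v → mem v u
    memEdge : ∀ {u v} → mem u v → IsEdge G u v
open EdgeSet public

Removed : (G : Graph) → EdgeSet G → Fin (n G) → Fin (n G) → Set
Removed G Ec u v = IsEdge G u v × ¬ mem Ec u v

Separates : (G : Graph) → EdgeSet G → Set
Separates G Ec = ¬ ConnectedRel (Removed G Ec)

HasP4 : (G : Graph) → EdgeSet G → Set
HasP4 G Ec =
  Σ (Fin (n G)) λ v0 → Σ (Fin (n G)) λ v1 → Σ (Fin (n G)) λ v2 →
  Σ (Fin (n G)) λ v3 → Σ (Fin (n G)) λ v4 →
    Unique (v0 ∷ v1 ∷ v2 ∷ v3 ∷ v4 ∷ []) ×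
    mem Ec v0 v1 × mem Ec v1 v2 × mem Ec v2 v3 × mem Ec v3 v4

data Color : Set where
  red blue : Color

-- An edge colouring: a colour for each ordered pair, required to agree on
-- both orientations of every edge (values on non-edges are irrelevant).
record EdgeColoring (G : Graph) : Set where
  field
    col    : Fin (n G) → Fin (n G) → Color
    colSym : ∀ u v → IsEdge G u v → col u v ≡ col v u
open EdgeColoring public

cycleEdges : {A : Set} → List A → List (A × A)
cycleEdges [] = []
cycleEdges (x ∷ xs) = go x (x ∷ xs)
  where
  go : _ → List _ → List (_ × _)
  go x0 [] = []
  go x0 (y ∷ []) = (y , x0) ∷ []
  go x0 (y ∷ z ∷ r) = (y , z) ∷ go x0 (z ∷ r)

IsCycle : (G : Graph) → List (Fin (n G)) → Set
IsCycle G vs = 3 ≤ length vs × Unique vs ×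
               All (λ e → IsEdge G (proj₁ e) (proj₂ e)) (cycleEdges vs)

_≟C_ : Color → Color → Bool
red ≟C red = true
blue ≟C blue = true
_ ≟C _ = false

countColor : {A : Set} → (A → A → Color) → Color → List (A × A) → ℕ
countColor c k [] = 0
countColor c k ((x , y) ∷ es) with c x y ≟C k
... | true  = suc (countColor c k es)
... | false = countColor c k es

IsNACColoring : (G : Graph) → EdgeColoring G → Set
IsNACColoring G δ =
  (∃[ u ] ∃[ v ] (IsEdge G u v × col δ u v ≡ red)) ×
  (∃[ u ] ∃[ v ] (IsEdge G u v × col δ u v ≡ blue)) ×
  (∀ vs → IsCycle G vs → countColor (col δ) blue (cycleEdges vs) ≢ 1) ×
  (∀ vs → IsCycle G vs → countColor (col δ) red  (cycleEdges vs) ≢ 1)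

HasNACColoring : Graph → Set
HasNACColoring G = ∃[ δ ] IsNACColoring G δ

module Submission where

-- Theorem 4.  The NAC-colouring is a cut colouring: for a vertex set S, an
-- edge is red iff exactly one endpoint lies in S.  A cycle crosses a cut an
-- even number of times, so it never has exactly one red edge.  A cycle with
-- exactly one blue edge is a path of crossing edges closed by a non-crossing
-- one: with three edges it is a triangle with two crossing edges, four edges
-- contradict parity, and longer ones contain five distinct vertices joined by
-- crossing edges.  So an "admissible" cut (some crossing and some non-crossing
-- edge, neither obstruction) gives a NAC-colouring (module Cut).  If c, t are
-- not joined in G − Ec, the component of c in G − Ec has all crossing edges in
-- Ec, hence no obstruction; if no edge fails to cross it, all edges lie in Ec
-- and a single-vertex cut works (module Separating).  As Ec is not decidable
-- but admissibility is, the theorem decides whether an admissible cut exists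
-- and refutes the negative case under a double negation, which lets us decide
-- reachability in G − Ec for the finitely many pairs of vertices.

open import Defs hiding (sym)
open import Data.Bool using (Bool; true; false; not; _xor_)
import Data.Bool as Bool
open import Data.Bool.Properties using (xor-assoc; xor-same; xor-comm; xor-identityʳ; ¬-not)
open import Data.Empty using (⊥; ⊥-elim)
open import Data.Nat using (ℕ; zero; suc; pred)
open import Data.Fin using (Fin; zero; suc; _≟_)
open import Data.Fin.Properties using (any?)
open import Data.Fin.Subset using (Subset)
open import Data.Fin.Subset.Properties using (anySubset?)
open import Data.Vec using (lookup; tabulate)
open import Data.Vec.Properties using (lookup∘tabulate)
open import Data.List using (List; []; _∷_; _++_; drop)
open import Data.List.Properties using (++-assoc; ++-identityʳ)
open import Data.List.Relation.Unary.All using (All; []; _∷_)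
open import Data.List.Relation.Unary.Unique.Propositional using (Unique)
open import Data.List.Relation.Unary.Unique.Propositional.Properties using (take⁺)
open import Data.List.Relation.Unary.Unique.DecPropositional using (unique?)
open import Data.List.Relation.Binary.Permutation.Propositional using (↭⇒↭ₛ)
open import Data.List.Relation.Binary.Permutation.Propositional.Properties using (++-comm)
open import Data.List.Relation.Binary.Permutation.Setoid.Properties using (Unique-resp-↭)
open import Data.Product using (Σ; ∃; ∃-syntax; _×_; _,_; proj₁; proj₂)
open import Data.Sum using (_⊎_; inj₁; inj₂; [_,_]′)
open import Relation.Nullary using (¬_; Dec; yes; no; does; proof)
open import Relation.Nullary.Decidable using (_×-dec_; ¬?; dec-true; dec-false; decidable-stable; ¬¬-excluded-middle)
open import Relation.Nullary.Reflects using (Reflects; invert)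
open import Relation.Binary.PropositionalEquality
  using (_≡_; _≢_; refl; sym; trans; cong; cong₂; subst; setoid; module ≡-Reasoning)

odd : ℕ → Bool
odd zero = false
odd (suc m) = not (odd m)

xor-telescope : ∀ a b c → (a xor b) xor (b xor c) ≡ a xor c
xor-telescope a b c = begin
  (a xor b) xor (b xor c)  ≡⟨ xor-assoc a b (b xor c) ⟩
  a xor (b xor (b xor c))  ≡⟨ cong (a xor_) (sym (xor-assoc b b c)) ⟩
  a xor ((b xor b) xor c)  ≡⟨ cong (λ d → a xor (d xor c)) (xor-same b) ⟩
  a xor c                  ∎
  where open ≡-Reasoning

three-crossings : ∀ a b c d → a xor b ≡ true → b xor c ≡ true → c xor d ≡ true → d xor a ≡ true
three-crossings true  false true  false _ _ _ = refl
three-crossings false true  false true  _ _ _ = refl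
three-crossings true  true  _     _     () _ _
three-crossings false false _     _     () _ _
three-crossings true  false false _     _ () _
three-crossings false true  true  _     _ () _
three-crossings true  false true  true  _ _ ()
three-crossings false true  false false _ _ ()

¬¬-∀-Fin : ∀ {m} {P : Fin m → Set} → (∀ i → ¬ ¬ P i) → ¬ ¬ (∀ i → P i)
¬¬-∀-Fin {zero} _ k = k (λ ())
¬¬-∀-Fin {suc m} {P} h k =
  h zero λ p₀ → ¬¬-∀-Fin {P = λ i → P (suc i)} (λ i → h (suc i)) λ ps →
    k λ { zero → p₀ ; (suc i) → ps i }

charVec : ∀ {m} {P : Fin m → Set} → (∀ v → Dec (P v)) → Subset m
charVec P? = tabulate (λ v → does (P? v))

module _ {m} {P : Fin m → Set} (P? : ∀ v → Dec (P v)) where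

  charVec-∈ : ∀ {v} → P v → lookup (charVec P?) v ≡ true
  charVec-∈ {v} p = trans (lookup∘tabulate _ v) (dec-true (P? v) p)

  charVec-∉ : ∀ {v} → ¬ P v → lookup (charVec P?) v ≡ false
  charVec-∉ {v} ¬p = trans (lookup∘tabulate _ v) (dec-false (P? v) ¬p)

  charVec-sound : ∀ {v} → lookup (charVec P?) v ≡ true → P v
  charVec-sound {v} eq =
    invert (subst (Reflects (P v)) (trans (sym (lookup∘tabulate _ v)) eq) (proof (P? v)))

walkBack : {A : Set} → A → List A → List (A × A)
walkBack x0 [] = []
walkBack x0 (y ∷ []) = (y , x0) ∷ []
walkBack x0 (y ∷ z ∷ r) = (y , z) ∷ walkBack x0 (z ∷ r)

cycleEdges-∷∷ : {A : Set} (x y : A) (r : List A) →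
  cycleEdges (x ∷ y ∷ r) ≡ (x , y) ∷ walkBack x (y ∷ r)
cycleEdges-∷∷ x y [] = refl
cycleEdges-∷∷ x y (z ∷ r) = cong (λ es → (x , y) ∷ (y , z) ∷ drop 1 es) (cycleEdges-∷∷ x z r)

cycleEdges≡walkBack : {A : Set} (x : A) (xs : List A) → cycleEdges (x ∷ xs) ≡ walkBack x (x ∷ xs)
cycleEdges≡walkBack x [] = refl
cycleEdges≡walkBack x (y ∷ r) = cycleEdges-∷∷ x y r

unique-rotate : {A : Set} (xs ys : List A) → Unique (xs ++ ys) → Unique (ys ++ xs)
unique-rotate {A} xs ys = Unique-resp-↭ (setoid A) (↭⇒↭ₛ (++-comm xs ys))

walk-snoc : ∀ {m} {R : Fin m → Fin m → Set} {u v w} → Walk R u v → R v w → Walk R u w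
walk-snoc here r = step r here
walk-snoc (step r′ w) r = step r′ (walk-snoc w r)

edge-sym : ∀ (G : Graph) {u v} → IsEdge G u v → IsEdge G v u
edge-sym G {u} {v} e = trans (Graph.sym G v u) e

no-loop : ∀ (G : Graph) {u} → ¬ IsEdge G u u
no-loop G {u} e with () ← trans (sym e) (irrefl G u)

colour : Bool → Color
colour true = red
colour false = blue

module Cut (G : Graph) (S : Fin (n G) → Bool) where

  V : Set
  V = Fin (n G)

  crosses : V → V → Bool
  crosses u v = S u xor S v

  Crossing : V → V → Set
  Crossing u v = IsEdge G u v × crosses u v ≡ true

  CrossingEdge NonCrossingEdge : Set
  CrossingEdge = ∃[ x ] ∃[ y ] Crossing x y
  NonCrossingEdge = ∃[ x ] ∃[ y ] (IsEdge G x y × crosses x y ≡ false)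

  cutColour : V → V → Color
  cutColour u v = colour (crosses u v)

  cutColoring : EdgeColoring G
  cutColoring = record { col = cutColour ; colSym = λ u v _ → cong colour (xor-comm (S u) (S v)) }

  walk-crosses : ∀ {u v} → Walk (IsEdge G) u v → S u ≡ true → S v ≡ false → CrossingEdge
  walk-crosses here Su Sv with () ← trans (sym Su) Sv
  walk-crosses {u} (step {v = w} e wk) Su Sv with S w in Sw
  ... | true = walk-crosses wk Sw Sv
  ... | false = u , w , e , cong₂ _xor_ Su Sw

  countRed countBlue : List (V × V) → ℕ
  countRed = countColor cutColour red
  countBlue = countColor cutColour blue

  odd-red-∷ : ∀ x y es → odd (countRed ((x , y) ∷ es)) ≡ crosses x y xor odd (countRed es)
  odd-red-∷ x y es with crosses x y
  ... | true = refl
  ... | false = refl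

  red-parity : ∀ x0 y l → odd (countRed (walkBack x0 (y ∷ l))) ≡ crosses y x0
  red-parity x0 y [] = trans (odd-red-∷ y x0 []) (xor-identityʳ (crosses y x0))
  red-parity x0 y (z ∷ l) = begin
    odd (countRed (walkBack x0 (y ∷ z ∷ l)))    ≡⟨ odd-red-∷ y z _ ⟩
    crosses y z xor odd (countRed (walkBack x0 (z ∷ l)))
                                                ≡⟨ cong (crosses y z xor_) (red-parity x0 z l) ⟩
    crosses y z xor crosses z x0                ≡⟨ xor-telescope (S y) (S z) (S x0) ⟩
    crosses y x0                                ∎
    where open ≡-Reasoning

  noCycleWithOneRed : ∀ vs → countRed (cycleEdges vs) ≢ 1
  noCycleWithOneRed [] ()
  noCycleWithOneRed (v ∷ vs) one
    with () ← trans (cong odd (sym one))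
                (trans (cong (λ es → odd (countRed es)) (cycleEdges≡walkBack v vs))
                  (trans (red-parity v v vs) (xor-same (S v))))

  noBlue-∷ : ∀ {x y es} → countBlue ((x , y) ∷ es) ≡ 0 → crosses x y ≡ true × countBlue es ≡ 0
  noBlue-∷ {x} {y} c0 with crosses x y
  ... | true = refl , c0

  oneBlue-∷ : ∀ {x y es} → countBlue ((x , y) ∷ es) ≡ 1 →
    (crosses x y ≡ false × countBlue es ≡ 0) ⊎ (crosses x y ≡ true × countBlue es ≡ 1)
  oneBlue-∷ {x} {y} c1 with crosses x y
  ... | true = inj₂ (refl , c1)
  ... | false = inj₁ (refl , cong pred c1)

  data CrossPath : V → V → List V → Set where
    stop  : ∀ x → CrossPath x x (x ∷ [])
    cross : ∀ {x y z l} → Crossing x y → CrossPath y z l → CrossPath x z (x ∷ l)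

  crossPath-snoc : ∀ {x y z l} → CrossPath x y l → Crossing y z → CrossPath x z (l ++ z ∷ [])
  crossPath-snoc (stop _) r = cross r (stop _)
  crossPath-snoc (cross r′ p) r = cross r′ (crossPath-snoc p r)

  ClosedCrossPath : Set
  ClosedCrossPath = Σ V λ x → Σ V λ z → Σ (List V) λ l →
    CrossPath x z l × Unique l × IsEdge G z x × crosses z x ≡ false

  CrossingCherry : Set
  CrossingCherry = Σ V λ u → Σ V λ w → Σ V λ v → Crossing u w × Crossing w v × IsEdge G v u

  CrossingP4 : Set
  CrossingP4 = Σ V λ v0 → Σ V λ v1 → Σ V λ v2 → Σ V λ v3 → Σ V λ v4 →
    Unique (v0 ∷ v1 ∷ v2 ∷ v3 ∷ v4 ∷ []) ×
    Crossing v0 v1 × Crossing v1 v2 × Crossing v2 v3 × Crossing v3 v4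

  closedCrossPath⇒obstruction : ClosedCrossPath → CrossingCherry ⊎ CrossingP4
  closedCrossPath⇒obstruction (_ , _ , _ , stop _ , _ , e , _) = ⊥-elim (no-loop G e)
  closedCrossPath⇒obstruction (a , b , _ , cross (_ , ab) (stop _) , _ , _ , ba)
    with () ← trans (sym ab) (trans (xor-comm (S a) (S b)) ba)
  closedCrossPath⇒obstruction (_ , _ , _ , cross r1 (cross r2 (stop _)) , _ , e , _) =
    inj₁ (_ , _ , _ , r1 , r2 , e)
  closedCrossPath⇒obstruction
    (a , d , _ , cross {y = b} (_ , ab) (cross {y = c} (_ , bc) (cross (_ , cd) (stop _))) , _ , _ , da)
    with () ← trans (sym (three-crossings (S a) (S b) (S c) (S d) ab bc cd)) da
  closedCrossPath⇒obstruction (_ , _ , _ , cross r1 (cross r2 (cross r3 (cross r4 (stop _)))) , u , _) =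
    inj₂ (_ , _ , _ , _ , _ , u , r1 , r2 , r3 , r4)
  closedCrossPath⇒obstruction (_ , _ , _ , cross r1 (cross r2 (cross r3 (cross r4 (cross _ _)))) , u , _) =
    inj₂ (_ , _ , _ , _ , _ , take⁺ 5 u , r1 , r2 , r3 , r4)

  EdgeList : List (V × V) → Set
  EdgeList = All (λ e → IsEdge G (proj₁ e) (proj₂ e))

  noBlue⇒crossPath : ∀ {x0 z l} w r → CrossPath x0 z l →
    EdgeList (walkBack x0 (w ∷ r)) → countBlue (walkBack x0 (w ∷ r)) ≡ 0 →
    CrossPath w z (w ∷ r ++ l)
  noBlue⇒crossPath w [] p (e ∷ []) c0 = cross (e , proj₁ (noBlue-∷ c0)) p
  noBlue⇒crossPath w (v ∷ r) p (e ∷ es) c0 =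
    cross (e , proj₁ (noBlue-∷ c0)) (noBlue⇒crossPath v r p es (proj₂ (noBlue-∷ c0)))

  -- Walking round a cycle l ++ rest with exactly one blue edge, where the part
  -- l already visited is a crossing path from the start x0 to the current y.
  oneBlue⇒closed : ∀ {x0 y l} rest → CrossPath x0 y l → Unique (l ++ rest) →
    EdgeList (walkBack x0 (y ∷ rest)) → countBlue (walkBack x0 (y ∷ rest)) ≡ 1 →
    ClosedCrossPath
  oneBlue⇒closed {x0} {y} {l} [] p u (e ∷ []) c1 with oneBlue-∷ c1
  ... | inj₁ (yx0 , _) = x0 , y , l , p , subst Unique (++-identityʳ l) u , e , yx0
  ... | inj₂ (_ , ())
  oneBlue⇒closed {y = y} {l} (w ∷ r) p u (e ∷ es) c1 with oneBlue-∷ c1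
  ... | inj₁ (yw , c0) =
    w , y , w ∷ r ++ l , noBlue⇒crossPath w r p es c0 , unique-rotate l (w ∷ r) u , e , yw
  ... | inj₂ (yw , c1′) =
    oneBlue⇒closed r (crossPath-snoc p (e , yw)) (subst Unique (sym (++-assoc l (w ∷ []) r)) u) es c1′

  oneBlue⇒closedCrossPath : ∀ vs → IsCycle G vs → countBlue (cycleEdges vs) ≡ 1 → ClosedCrossPath
  oneBlue⇒closedCrossPath [] (() , _)
  oneBlue⇒closedCrossPath (v ∷ vs) (_ , u , es) c1 =
    oneBlue⇒closed vs (stop v) u (subst EdgeList eq es) (subst (λ l → countBlue l ≡ 1) eq c1)
    where eq = cycleEdges≡walkBack v vs

  Admissible : Set
  Admissible = CrossingEdge × NonCrossingEdge × ¬ CrossingCherry × ¬ CrossingP4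

  admissible⇒NAC : Admissible → HasNACColoring G
  admissible⇒NAC ((x , y , e , xy) , (x′ , y′ , e′ , x′y′) , ¬cherry , ¬p4) =
    cutColoring , (x , y , e , cong colour xy) , (x′ , y′ , e′ , cong colour x′y′) ,
    (λ vs cyc one → [ ¬cherry , ¬p4 ]′ (closedCrossPath⇒obstruction (oneBlue⇒closedCrossPath vs cyc one))) ,
    (λ vs _ → noCycleWithOneRed vs)

  edge? : ∀ x y → Dec (IsEdge G x y)
  edge? x y = adj G x y Bool.≟ true

  crossing? : ∀ x y → Dec (Crossing x y)
  crossing? x y = edge? x y ×-dec (crosses x y Bool.≟ true)

  nonCrossingEdge? : Dec NonCrossingEdge
  nonCrossingEdge? = any? λ x → any? λ y → edge? x y ×-dec (crosses x y Bool.≟ false)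

  admissible? : Dec Admissible
  admissible? =
    (any? λ x → any? λ y → crossing? x y) ×-dec (nonCrossingEdge? ×-dec (¬? cherry? ×-dec ¬? p4?))
    where
    cherry? : Dec CrossingCherry
    cherry? = any? λ u → any? λ w → any? λ v → crossing? u w ×-dec (crossing? w v ×-dec edge? v u)
    p4? : Dec CrossingP4
    p4? = any? λ v0 → any? λ v1 → any? λ v2 → any? λ v3 → any? λ v4 →
      unique? _≟_ (v0 ∷ v1 ∷ v2 ∷ v3 ∷ v4 ∷ []) ×-dec
      (crossing? v0 v1 ×-dec (crossing? v1 v2 ×-dec (crossing? v2 v3 ×-dec crossing? v3 v4)))

ExposedEdge : Graph → Set
ExposedEdge G = Σ (Fin (n G)) λ u → Σ (Fin (n G)) λ v → Σ (Fin (n G)) λ x → Σ (Fin (n G)) λ y →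
  IsEdge G u v × IsEdge G x y × u ≢ x × u ≢ y

twoEdges⇒exposedEdge : ∀ G → AtLeastTwoEdges G → ExposedEdge G
twoEdges⇒exposedEdge G (p , q , x , y , e , e′ , distinct) with onPair p | onPair q
  where
  onPair : ∀ u → (u ≡ x ⊎ u ≡ y) ⊎ (u ≢ x × u ≢ y)
  onPair u with u ≟ x | u ≟ y
  ... | yes ux | _ = inj₁ (inj₁ ux)
  ... | no _ | yes uy = inj₁ (inj₂ uy)
  ... | no u≢x | no u≢y = inj₂ (u≢x , u≢y)
... | inj₂ (p≢x , p≢y) | _ = p , q , x , y , e , e′ , p≢x , p≢y
... | inj₁ _ | inj₂ (q≢x , q≢y) = q , p , x , y , edge-sym G e , e′ , q≢x , q≢y
... | inj₁ (inj₁ refl) | inj₁ (inj₁ refl) = ⊥-elim (no-loop G e)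
... | inj₁ (inj₁ refl) | inj₁ (inj₂ refl) = ⊥-elim (distinct (inj₁ (refl , refl)))
... | inj₁ (inj₂ refl) | inj₁ (inj₁ refl) = ⊥-elim (distinct (inj₂ (refl , refl)))
... | inj₁ (inj₂ refl) | inj₁ (inj₂ refl) = ⊥-elim (no-loop G e)

module Separating (G : Graph) (Ec : EdgeSet G)
  (connecting : ∀ {u v} → mem Ec u v → IsConnectingEdge G u v) (noP4 : HasP4 G Ec → ⊥) where

  open Cut G

  -- A cut, given as a subset vector so that its existence is decidable.
  AdmissibleCut : Set
  AdmissibleCut = ∃ λ (s : Subset (n G)) → Admissible (lookup s)

  -- If all crossing edges lie in Ec, the cut has no obstruction: an edge of Ec
  -- lies in no triangle, and Ec contains no path of length four.
  crossingInEc⇒noObstruction : ∀ S → (∀ {x y} → Crossing S x y → ¬ ¬ mem Ec x y) →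
    ¬ CrossingCherry S × ¬ CrossingP4 S
  crossingInEc⇒noObstruction S inEc =
    (λ { (u , w , v , uw , wv , vu) → inEc uw λ m →
           proj₂ (connecting m) (v , edge-sym G vu , proj₁ wv) }) ,
    (λ { (v0 , v1 , v2 , v3 , v4 , u , r1 , r2 , r3 , r4) →
           inEc r1 λ m1 → inEc r2 λ m2 → inEc r3 λ m3 → inEc r4 λ m4 →
           noP4 (v0 , v1 , v2 , v3 , v4 , u , m1 , m2 , m3 , m4) })

  ClosedOutsideEc : (Fin (n G) → Bool) → Set
  ClosedOutsideEc S = ∀ {x y} → Removed G Ec x y → S x ≡ true → S y ≡ true

  closed⇒crossingInEc : ∀ {S} → ClosedOutsideEc S → ∀ {x y} → Crossing S x y → ¬ ¬ mem Ec x y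
  closed⇒crossingInEc {S} closed {x} {y} (e , _) ¬m with S x in Sx | S y in Sy
  ... | true | false with () ← trans (sym (closed (e , ¬m) Sx)) Sy
  ... | false | true with () ← trans (sym (closed (edge-sym G e , λ m → ¬m (memSym Ec m)) Sy)) Sx

  -- If every edge lies in Ec, the cut around the exposed endpoint of an edge
  -- is admissible: that edge crosses it and the other edge does not.
  allInEc⇒admissibleCut : (∀ {x y} → IsEdge G x y → ¬ ¬ mem Ec x y) → AtLeastTwoEdges G → AdmissibleCut
  allInEc⇒admissibleCut inEc two with twoEdges⇒exposedEdge G two
  ... | u , v , x , y , uv , xy , u≢x , u≢y =
    s , (u , v , uv , cong₂ _xor_ (charVec-∈ at? refl) (outside v≢u)) ,
        (x , y , xy , cong₂ _xor_ (outside (λ xu → u≢x (sym xu))) (outside (λ yu → u≢y (sym yu)))) ,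
        crossingInEc⇒noObstruction (lookup s) (λ r → inEc (proj₁ r))
    where
    at? = λ w → w ≟ u
    s = charVec at?
    outside : ∀ {w} → w ≢ u → lookup s w ≡ false
    outside = charVec-∉ at?
    v≢u : v ≢ u
    v≢u refl = no-loop G uv

  module _ (conn : Connected G) (two : AtLeastTwoEdges G) (sep : Separates G Ec)
           (reach? : ∀ u v → Dec (Walk (Removed G Ec) u v)) where

    unreachablePair : ∃[ c ] ∃[ t ] ¬ Walk (Removed G Ec) c t
    unreachablePair with any? (λ c → any? λ t → ¬? (reach? c t))
    ... | yes pair = pair
    ... | no none = ⊥-elim (sep λ u v → decidable-stable (reach? u v) λ ¬w → none (u , v , ¬w))

    -- The component of c in G − Ec, for c not joined to t, gives an admissible
    -- cut unless every edge crosses it.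
    admissibleCut : AdmissibleCut
    admissibleCut with unreachablePair
    ... | c , t , c↛t = choose (nonCrossingEdge? S)
      where
      s = charVec (reach? c)
      S = lookup s
      closed : ClosedOutsideEc S
      closed r Sx = charVec-∈ (reach? c) (walk-snoc (charVec-sound (reach? c) Sx) r)
      choose : Dec (NonCrossingEdge S) → AdmissibleCut
      choose (yes nonCrossing) =
        s , walk-crosses S (conn c t) (charVec-∈ (reach? c) here) (charVec-∉ (reach? c) c↛t) , nonCrossing ,
        crossingInEc⇒noObstruction S (closed⇒crossingInEc closed)
      choose (no noBlue) = allInEc⇒admissibleCut
        (λ {x} {y} e → closed⇒crossingInEc closed (e , ¬-not λ xy → noBlue (x , y , e , xy))) two

theorem4 : (G : Graph) → Connected G → AtLeastTwoEdges G →
    (Ec : EdgeSet G) →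
    (∀ {u v} → mem Ec u v → IsConnectingEdge G u v) →
    Separates G Ec → (HasP4 G Ec → ⊥) →
    HasNACColoring G
theorem4 G conn two Ec connecting sep noP4 with anySubset? (λ s → Cut.admissible? G (lookup s))
... | yes (s , adm) = Cut.admissible⇒NAC G (lookup s) adm
... | no none = ⊥-elim (¬¬-∀-Fin (λ u → ¬¬-∀-Fin λ v → ¬¬-excluded-middle) λ reach? →
    none (Separating.admissibleCut G Ec connecting noP4 conn two sep reach?))
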